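{- Let $m_1,m_2$ be integers with $1 \leq m_1 \leq m_2$, and let $G = K_{1,m_1} + K_{1,m_2}$ be the disjoint union of the stars $K_{1,m_1}$ and $K_{1,m_2}$. Then $G$ is equitably 2-choosable if and only if $m_2 - m_1 \leq 1$ and $m_1 + m_2 \leq 15$.
   Context: All graphs are finite and simple. A list assignment $L$ for a graph $G$ assigns to each vertex $v$ a set $L(v)$ of colors; it is a $k$-assignment if $|L(v)|=k$ for all $v$. The palette of $L$ is $\bigcup_{v \in V(G)} L(v)$. A proper $L$-coloring is a proper coloring $f$ with $f(v)\in L(v)$ for all $v$. If $L$ is a $k$-assignment, an equitable $L$-coloring of $G$ is a proper $L$-coloring in which each color of the palette appears on at most $\lceil |V(G)|/k \rceil$ vertices. $G$ is equitably $k$-choosable if an equitable $L$-coloring exists for every $k$-assignment $L$ for $G$. $G_1+G_2$ denotes the disjoint union of vertex-disjoint graphs $G_1$ and $G_2$. -}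

module Defs where

open import Data.Nat using (ℕ; zero; suc; _+_; _*_; _∸_; _≤_; NonZero)
open import Data.Nat.DivMod using (_/_)
open import Data.Fin using (Fin; zero; suc; splitAt)
open import Data.Sum using (_⊎_; inj₁; inj₂)
open import Data.Product using (_×_; Σ; ∃; _,_)
open import Data.Empty using (⊥)
open import Data.List using (List; length; filter; allFin)
open import Data.Vec using (Vec; lookup)
open import Data.Vec.Membership.Propositional using (_∈_)
open import Relation.Nullary using (¬_)
open import Relation.Binary.PropositionalEquality using (_≡_; _≢_)
open import Function.Definitions using (Injective)
import Data.Nat.Properties as ℕP

record Graph : Set₁ where
  field
    order : ℕ
    Adj   : Fin order → Fin order → Set
open Graph public

Star : ℕ → Graph
Star m = record { order = suc m ; Adj = λ i j → (i ≡ zero × j ≢ zero) ⊎ (j ≡ zero × i ≢ zero) }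

-- Disjoint union G₁ + G₂ on Fin (n₁ + n₂): the first n₁ vertices are G₁, the rest G₂.
private
  AdjSum : (G₁ G₂ : Graph) → Fin (order G₁) ⊎ Fin (order G₂) → Fin (order G₁) ⊎ Fin (order G₂) → Set
  AdjSum G₁ G₂ (inj₁ a) (inj₁ b) = Adj G₁ a b
  AdjSum G₁ G₂ (inj₂ a) (inj₂ b) = Adj G₂ a b
  AdjSum G₁ G₂ (inj₁ _) (inj₂ _) = ⊥
  AdjSum G₁ G₂ (inj₂ _) (inj₁ _) = ⊥

_⊕_ : Graph → Graph → Graph
G₁ ⊕ G₂ = record
  { order = order G₁ + order G₂
  ; Adj   = λ i j → AdjSum G₁ G₂ (splitAt (order G₁) i) (splitAt (order G₁) j) }

Colour : Set
Colour = ℕ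

record Assignment (G : Graph) (k : ℕ) : Set where
  field
    lists    : Fin (order G) → Vec Colour k
    distinct : ∀ v → Injective _≡_ _≡_ (lookup (lists v))
open Assignment public

⌈_/_⌉ : (n k : ℕ) → .{{NonZero k}} → ℕ
⌈ n / k ⌉ = (n + (k ∸ 1)) / k

colourClassSize : (G : Graph) → (Fin (order G) → Colour) → Colour → ℕ
colourClassSize G f c = length (filter (λ v → f v ℕP.≟ c) (allFin (order G)))

IsProperLColouring : (G : Graph) {k : ℕ} → Assignment G k → (Fin (order G) → Colour) → Set
IsProperLColouring G L f =
  (∀ v → f v ∈ lists L v) × (∀ u v → Adj G u v → f u ≢ f v)

IsEquitableLColouring : (G : Graph) (k : ℕ) .{{_ : NonZero k}} → Assignment G k → (Fin (order G) → Colour) → Set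
IsEquitableLColouring G k L f =
  IsProperLColouring G L f × (∀ c → colourClassSize G f c ≤ ⌈ order G / k ⌉)

EquitablyChoosable : (G : Graph) (k : ℕ) .{{_ : NonZero k}} → Set
EquitablyChoosable G k =
  (L : Assignment G k) → ∃ λ f → IsEquitableLColouring G k L f

-- A greedy lemma colours vertices with option pairs (a , b) (forced when
-- a = b) within a budget B once every colour c is forced on at most B c vertices and
-- any two colours have budget at least N.  With centre colours c₁, c₂ fixed, a leaf is
-- forced exactly when its list contains its centre's colour, so we need c₁, c₂ forcing
-- no colour on more than t leaves.  Counting leaves by their lists shows that if all
-- four choices of (c₁, c₂) failed, two or four overloaded colours would need more
-- leaves than exist; the resulting numerical conditions are checked by evaluation.  With {0, 1} on star 2, its centre takes y and its m₂ leaves the other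
-- colour y′, so star 1 may use y′ at most t - m₂ times; for m₂ ≥ m₁ + 2 resp.
-- 8 ≤ m₁ ≤ m₂ we give lists to star 1 forcing one resp. two vertices of colour y′.
module Submission where

open import Defs
open import Data.Nat using (ℕ; zero; suc; _+_; _*_; _∸_; _≤_; _<_; z≤n; s≤s; _≟_; _≤?_; _<?_)
open import Data.Nat.Properties
open import Data.Nat.DivMod using (m<n*o⇒m/o<n)
open import Data.Nat.Tactic.RingSolver using (solve-∀)
open import Algebra.Properties.CommutativeSemigroup +-commutativeSemigroup using (interchange)
open import Algebra.Properties.CommutativeMonoid.Sum +-0-commutativeMonoid
  using (sum; sum-cong-≗; ∑-distrib-+)
open import Data.Fin using (Fin; zero; suc; splitAt; join; _↑ˡ_; _↑ʳ_; inject₁)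
open import Data.Fin.Patterns using (0F; 1F; 2F; 3F; 4F; 5F; 6F; 7F)
open import Data.Fin.Properties using (splitAt-↑ˡ; splitAt-↑ʳ; join-splitAt; any?)
open import Data.Vec using (Vec; []; _∷_; lookup)
open import Data.Vec.Functional using () renaming (_∷_ to _◂_)
open import Data.Vec.Membership.Propositional using (_∈_)
open import Data.Vec.Relation.Unary.Any using (here; there)
open import Data.List using (length; filter; tabulate)
open import Data.Sum using (_⊎_; inj₁; inj₂; [_,_]′) renaming (map to ⊎-map)
open import Data.Product using (_×_; _,_; proj₁; proj₂; ∃; ∃₂)
open import Data.Empty using (⊥; ⊥-elim)
open import Function using (_∘_; id)
open import Function.Bundles using (_⇔_; mk⇔)
open import Function.Definitions using (Injective)
open import Relation.Nullary using (¬_; Dec; yes; no)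
open import Relation.Nullary.Decidable using (True; toWitness; _×-dec_)
open import Relation.Unary using (Decidable)
open import Relation.Binary.PropositionalEquality
  using (_≡_; _≢_; refl; sym; trans; cong; cong₂; subst; subst₂; ≢-sym)

χ : ∀ {P : Set} → Dec P → ℕ
χ (yes _) = 1
χ (no _)  = 0

χ≤1 : ∀ {P : Set} (d : Dec P) → χ d ≤ 1
χ≤1 (yes _) = s≤s z≤n
χ≤1 (no _)  = z≤n

χ-yes : ∀ {P : Set} (d : Dec P) → P → 1 ≤ χ d
χ-yes (yes _) _ = s≤s z≤n
χ-yes (no ¬p) p = ⊥-elim (¬p p)

count : ∀ {n} → (Fin n → Colour) → Colour → ℕ
count g c = sum (λ v → χ (g v ≟ c))

sum-bound : ∀ {n} (f : Fin n → ℕ) {k} → (∀ i → f i ≤ k) → sum f ≤ n * k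
sum-bound {zero}  f le = z≤n
sum-bound {suc n} f le = +-mono-≤ (le zero) (sum-bound (f ∘ suc) (le ∘ suc))

sum-≥ : ∀ {n} {f : Fin n → ℕ} → (∀ i → 1 ≤ f i) → n ≤ sum f
sum-≥ {zero}  le = z≤n
sum-≥ {suc n} le = +-mono-≤ (le zero) (sum-≥ (le ∘ suc))

sum-≥-term : ∀ {n} (f : Fin n → ℕ) i → f i ≤ sum f
sum-≥-term f zero    = m≤m+n (f zero) _
sum-≥-term f (suc i) = ≤-trans (sum-≥-term (f ∘ suc) i) (m≤n+m _ (f zero))

sum-≥-consecutive : ∀ {n} (f : Fin (suc n) → ℕ) (p : Fin n) → f (inject₁ p) + f (suc p) ≤ sum f
sum-≥-consecutive {suc n} f zero    = +-monoʳ-≤ (f zero) (m≤m+n _ _)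
sum-≥-consecutive {suc n} f (suc p) = ≤-trans (sum-≥-consecutive (f ∘ suc) p) (m≤n+m _ (f zero))

sum-pos : ∀ {n} (f : Fin n → ℕ) → 0 < sum f → ∃ λ i → 0 < f i
sum-pos {suc n} f pos with f zero in eq
... | suc _ = zero , subst (0 <_) (sym eq) (s≤s z≤n)
... | zero with sum-pos (f ∘ suc) pos
...   | i , fi>0 = suc i , fi>0

sum-++ : ∀ a {b} (f : Fin (a + b) → ℕ) →
  sum f ≡ sum (λ i → f (i ↑ˡ b)) + sum (λ j → f (a ↑ʳ j))
sum-++ zero    f = refl
sum-++ (suc a) f = trans (cong (f zero +_) (sum-++ a (f ∘ suc))) (sym (+-assoc (f zero) _ _))

length-filter-tabulate : ∀ {A : Set} {P : A → Set} (P? : Decidable P) {n} (g : Fin n → A) →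
  length (filter P? (tabulate g)) ≡ sum (λ i → χ (P? (g i)))
length-filter-tabulate P? {zero}  g = refl
length-filter-tabulate P? {suc n} g with P? (g zero)
... | yes _ = cong suc (length-filter-tabulate P? (g ∘ suc))
... | no _  = length-filter-tabulate P? (g ∘ suc)

colourClassSize≡count : ∀ G f c → colourClassSize G f c ≡ count f c
colourClassSize≡count G f c = length-filter-tabulate (λ v → f v ≟ c) id

χ-exclusive : ∀ a {c d} → c ≢ d → χ (a ≟ c) + χ (a ≟ d) ≤ 1
χ-exclusive a {c} {d} c≢d with a ≟ c | a ≟ d
... | yes a≡c | yes a≡d = ⊥-elim (c≢d (trans (sym a≡c) a≡d))
... | yes _   | no _    = s≤s z≤n
... | no _    | yes _   = s≤s z≤n
... | no _    | no _    = z≤n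

count-two : ∀ {n} (g : Fin n → Colour) {a b} → a ≢ b → count g a + count g b ≤ n
count-two {n} g {a} {b} a≢b = begin
  count g a + count g b                   ≡⟨ sym (∑-distrib-+ (λ v → χ (g v ≟ a)) (λ v → χ (g v ≟ b))) ⟩
  sum (λ v → χ (g v ≟ a) + χ (g v ≟ b))  ≤⟨ sum-bound _ (λ v → χ-exclusive (g v) a≢b) ⟩
  n * 1                                   ≡⟨ *-identityʳ n ⟩
  n                                       ∎
  where open ≤-Reasoning

Options : Set
Options = Colour × Colour

_∈ₒ_ : Colour → Options → Set
x ∈ₒ (a , b) = x ≡ a ⊎ x ≡ b

-- 1 when the options force colour c, i.e. (a , b) = (c , c), and 0 otherwise.
forcedAt : Options → Colour → ℕ
forcedAt (a , b) c = χ (a ≟ c) * χ (b ≟ c)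

∈ₒ-diag : ∀ {x a} → x ∈ₒ (a , a) → x ≡ a
∈ₒ-diag (inj₁ x≡a) = x≡a
∈ₒ-diag (inj₂ x≡a) = x≡a

forcedAt-diag : ∀ {a b} c → a ≡ b → forcedAt (a , b) c ≡ χ (a ≟ c)
forcedAt-diag {a} c refl with a ≟ c
... | yes _ = refl
... | no _  = refl

record Choice (n : ℕ) (o : Fin n → Options) (B : Colour → ℕ) : Set where
  constructor choice
  field
    colour : Fin n → Colour
    chosen : ∀ v → colour v ∈ₒ o v
    within : ∀ c → count colour c ≤ B c

budget-shrink : ∀ {n} x y i j → i + j ≤ 1 → suc n ≤ x + y → n ≤ (x ∸ i) + (y ∸ j)
budget-shrink     x       y       0 0 _ room       = ≤-trans (n≤1+n _) room
budget-shrink     zero    y       1 0 _ room       = ≤-trans (n≤1+n _) room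
budget-shrink     (suc x) y       1 0 _ (s≤s room) = room
budget-shrink     x       zero    0 1 _ room       = ≤-trans (n≤1+n _) room
budget-shrink {n} x       (suc y) 0 1 _ room       = ≤-pred (subst (suc n ≤_) (+-suc x y) room)
budget-shrink     _ _ 0             (suc (suc _)) (s≤s ()) _
budget-shrink     _ _ 1             (suc _)       (s≤s ()) _
budget-shrink     _ _ (suc (suc _)) _             (s≤s ()) _

extend-forced : ∀ {n} {o : Fin (suc n) → Options} {B} →
  let a = proj₁ (o zero) in
  (∀ c → χ (a ≟ c) ≤ B c) → Choice n (o ∘ suc) (λ c → B c ∸ χ (a ≟ c)) → Choice (suc n) o B
extend-forced {o = o} {B} fits (choice g chosen within) =
  choice (proj₁ (o zero) ◂ g) (λ { zero → inj₁ refl ; (suc v) → chosen v })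
    (λ c → subst (_ ≤_) (m+[n∸m]≡n (fits c)) (+-monoʳ-≤ (χ (proj₁ (o zero) ≟ c)) (within c)))

count-extend : ∀ {n} (g : Fin n → Colour) {B : Colour → ℕ} {e} →
  count g e < B e → (∀ c → count g c ≤ B c) → ∀ c → count (e ◂ g) c ≤ B c
count-extend g {e = e} spare within c with e ≟ c
... | yes refl = spare
... | no _     = within c

-- A free vertex takes an option whose colour still has room; since its two colours
-- together have budget at least n + 1, one of them does.
extend-free : ∀ {n} {o : Fin (suc n) → Options} {B} →
  let (a , b) = o zero in
  a ≢ b → suc n ≤ B a + B b → Choice n (o ∘ suc) B → Choice (suc n) o B
extend-free {n} {o} {B} a≢b room (choice g chosen within)
  with count g (proj₁ (o zero)) <? B (proj₁ (o zero)) | count g (proj₂ (o zero)) <? B (proj₂ (o zero))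
... | yes spare | _         =
  choice (_ ◂ g) (λ { zero → inj₁ refl ; (suc v) → chosen v }) (count-extend g spare within)
... | no _      | yes spare =
  choice (_ ◂ g) (λ { zero → inj₂ refl ; (suc v) → chosen v }) (count-extend g spare within)
... | no full-a | no full-b = ⊥-elim (<-irrefl refl (begin-strict
  n                                                    <⟨ room ⟩
  B (proj₁ (o zero)) + B (proj₂ (o zero))              ≤⟨ +-mono-≤ (≮⇒≥ full-a) (≮⇒≥ full-b) ⟩
  count g (proj₁ (o zero)) + count g (proj₂ (o zero))  ≤⟨ count-two g a≢b ⟩
  n                                                    ∎))
  where open ≤-Reasoning

greedy : ∀ n (o : Fin n → Options) (B : Colour → ℕ) →
  (∀ c → sum (λ v → forcedAt (o v) c) ≤ B c) →
  (∀ c d → c ≢ d → n ≤ B c + B d) →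
  Choice n o B
greedy zero    o B forced room = choice (λ ()) (λ ()) (λ _ → z≤n)
greedy (suc n) o B forced room with proj₁ (o zero) ≟ proj₂ (o zero)
... | yes a≡b = extend-forced fits (greedy n (o ∘ suc) (λ c → B c ∸ χ (a ≟ c)) forced′ room′)
  where
  a : Colour
  a = proj₁ (o zero)
  rest : Colour → ℕ
  rest c = sum (λ v → forcedAt (o (suc v)) c)
  forced-split : ∀ c → χ (a ≟ c) + rest c ≤ B c
  forced-split c = subst (λ k → k + rest c ≤ B c) (forcedAt-diag c a≡b) (forced c)
  fits : ∀ c → χ (a ≟ c) ≤ B c
  fits c = m+n≤o⇒m≤o _ (forced-split c)
  forced′ : ∀ c → rest c ≤ B c ∸ χ (a ≟ c)
  forced′ c = m+n≤o⇒m≤o∸n _ (subst (_≤ B c) (+-comm (χ (a ≟ c)) _) (forced-split c))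
  room′ : ∀ c d → c ≢ d → n ≤ (B c ∸ χ (a ≟ c)) + (B d ∸ χ (a ≟ d))
  room′ c d c≢d =
    budget-shrink (B c) (B d) (χ (a ≟ c)) (χ (a ≟ d)) (χ-exclusive a c≢d) (room c d c≢d)
... | no a≢b = extend-free a≢b (room _ _ a≢b) (greedy n (o ∘ suc) B forced′ room′)
  where
  forced′ : ∀ c → sum (λ v → forcedAt (o (suc v)) c) ≤ B c
  forced′ c = m+n≤o⇒n≤o (forcedAt (o zero) c) (forced c)
  room′ : ∀ c d → c ≢ d → n ≤ B c + B d
  room′ c d c≢d = ≤-trans (n≤1+n n) (room c d c≢d)

Distinct : Vec Colour 2 → Set
Distinct l = lookup l 0F ≢ lookup l 1F

injective⇒distinct : ∀ {l : Vec Colour 2} → Injective _≡_ _≡_ (lookup l) → Distinct l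
injective⇒distinct inj e with inj e
... | ()

distinct⇒injective : ∀ {l : Vec Colour 2} → Distinct l → Injective _≡_ _≡_ (lookup l)
distinct⇒injective {u ∷ w ∷ []} u≢w {0F} {0F} _ = refl
distinct⇒injective {u ∷ w ∷ []} u≢w {0F} {1F} e = ⊥-elim (u≢w e)
distinct⇒injective {u ∷ w ∷ []} u≢w {1F} {0F} e = ⊥-elim (u≢w (sym e))
distinct⇒injective {u ∷ w ∷ []} u≢w {1F} {1F} _ = refl

∈-pair : ∀ {x a b : Colour} → x ∈ (a ∷ b ∷ []) → x ≡ a ⊎ x ≡ b
∈-pair (here x≡a)         = inj₁ x≡a
∈-pair (there (here x≡b)) = inj₂ x≡b

the-other : ∀ {x a b : Colour} → x ∈ (a ∷ b ∷ []) → x ≢ a → x ≡ b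
the-other x∈ x≢a = [ (λ x≡a → ⊥-elim (x≢a x≡a)) , id ]′ (∈-pair x∈)

leafOptions : Colour → Vec Colour 2 → Options
leafOptions c (u ∷ w ∷ []) with u ≟ c | w ≟ c
... | yes _ | _     = (w , w)
... | no _  | yes _ = (u , u)
... | no _  | no _  = (u , w)

leafOptions-∈ : ∀ c l {x} → x ∈ₒ leafOptions c l → x ∈ l
leafOptions-∈ c (u ∷ w ∷ []) x∈ with u ≟ c | w ≟ c | x∈
... | yes _ | _     | inj₁ refl = there (here refl)
... | yes _ | _     | inj₂ refl = there (here refl)
... | no _  | yes _ | inj₁ refl = here refl
... | no _  | yes _ | inj₂ refl = here refl
... | no _  | no _  | inj₁ refl = here refl
... | no _  | no _  | inj₂ refl = there (here refl)

leafOptions-avoid : ∀ c l {x} → Distinct l → x ∈ₒ leafOptions c l → x ≢ c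
leafOptions-avoid c (u ∷ w ∷ []) u≢w x∈ with u ≟ c | w ≟ c | x∈
... | yes u≡c | _       | inj₁ refl = λ w≡c → u≢w (trans u≡c (sym w≡c))
... | yes u≡c | _       | inj₂ refl = λ w≡c → u≢w (trans u≡c (sym w≡c))
... | no _    | yes w≡c | inj₁ refl = λ u≡c → u≢w (trans u≡c (sym w≡c))
... | no _    | yes w≡c | inj₂ refl = λ u≡c → u≢w (trans u≡c (sym w≡c))
... | no u≢c  | no _    | inj₁ refl = u≢c
... | no _    | no w≢c  | inj₂ refl = w≢c

forces : Colour → Colour → Vec Colour 2 → ℕ
forces c x l = forcedAt (leafOptions c l) x

forces-≤1 : ∀ c x l → forces c x l ≤ 1
forces-≤1 c x l with leafOptions c l
... | (a , b) = *-mono-≤ (χ≤1 (a ≟ x)) (χ≤1 (b ≟ x))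

forcedAt-pos : ∀ o x → 0 < forcedAt o x → proj₁ o ≡ x × proj₂ o ≡ x
forcedAt-pos (a , b) x pos with a ≟ x | b ≟ x
... | yes a≡x | yes b≡x = a≡x , b≡x
... | yes _   | no _    = ⊥-elim (<-irrefl refl pos)
... | no _    | yes _   = ⊥-elim (<-irrefl refl pos)
... | no _    | no _    = ⊥-elim (<-irrefl refl pos)

Spans : Vec Colour 2 → Colour → Colour → Set
Spans (u ∷ w ∷ []) c x = (u ≡ c × w ≡ x) ⊎ (w ≡ c × u ≡ x)

forces-spans : ∀ c x l → Distinct l → 0 < forces c x l → Spans l c x
forces-spans c x (u ∷ w ∷ []) u≢w pos
  with u ≟ c | w ≟ c | forcedAt-pos (leafOptions c (u ∷ w ∷ [])) x pos
... | yes u≡c | _       | w≡x , _   = inj₁ (u≡c , w≡x)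
... | no _    | yes w≡c | u≡x , _   = inj₂ (w≡c , u≡x)
... | no _    | no _    | u≡x , w≡x = ⊥-elim (u≢w (trans u≡x (sym w≡x)))

SamePair : Colour → Colour → Colour → Colour → Set
SamePair c x c′ y = (c ≡ c′ × x ≡ y) ⊎ (c ≡ y × x ≡ c′)

spans-unique : ∀ l {c x c′ y} → Spans l c x → Spans l c′ y → SamePair c x c′ y
spans-unique (u ∷ w ∷ []) (inj₁ (refl , refl)) (inj₁ (refl , refl)) = inj₁ (refl , refl)
spans-unique (u ∷ w ∷ []) (inj₁ (refl , refl)) (inj₂ (refl , refl)) = inj₂ (refl , refl)
spans-unique (u ∷ w ∷ []) (inj₂ (refl , refl)) (inj₁ (refl , refl)) = inj₂ (refl , refl)
spans-unique (u ∷ w ∷ []) (inj₂ (refl , refl)) (inj₂ (refl , refl)) = inj₁ (refl , refl)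

¬same-centre : ∀ {c x y} → x ≢ y → ¬ SamePair c x c y
¬same-centre x≢y (inj₁ (_ , x≡y))   = x≢y x≡y
¬same-centre x≢y (inj₂ (c≡y , x≡c)) = x≢y (trans x≡c c≡y)

¬cross : ∀ {c x c′ y} → c ≢ c′ → ¬ (x ≡ c′ × y ≡ c) → ¬ SamePair c x c′ y
¬cross c≢c′ _     (inj₁ (c≡c′ , _))   = c≢c′ c≡c′
¬cross _    ¬swap (inj₂ (c≡y , x≡c′)) = ¬swap (x≡c′ , sym c≡y)

Exclusive : ℕ → ℕ → Set
Exclusive a b = 0 < a → 0 < b → ⊥

pos-+ : ∀ {a b} → 0 < a + b → 0 < a ⊎ 0 < b
pos-+ {suc a} _   = inj₁ (s≤s z≤n)
pos-+ {zero}  pos = inj₂ pos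

exclusive₂ : ∀ {a b} → a ≤ 1 → b ≤ 1 → Exclusive a b → a + b ≤ 1
exclusive₂ {zero}        _ b≤1 _  = b≤1
exclusive₂ {suc zero} {zero}  _ _ _  = s≤s z≤n
exclusive₂ {suc zero} {suc _} _ _ ex = ⊥-elim (ex (s≤s z≤n) (s≤s z≤n))
exclusive₂ {suc (suc _)} (s≤s ()) _ _

exclusive₄ : ∀ {a b c d} → a ≤ 1 → b ≤ 1 → c ≤ 1 → d ≤ 1 →
  Exclusive a b → Exclusive a c → Exclusive a d →
  Exclusive b c → Exclusive b d → Exclusive c d → (a + b) + (c + d) ≤ 1
exclusive₄ ha hb hc hd ab ac ad bc bd cd = exclusive₂ (exclusive₂ ha hb ab) (exclusive₂ hc hd cd)
  (λ a+b>0 c+d>0 → [ (λ a>0 → [ ac a>0 , ad a>0 ]′ (pos-+ c+d>0)) ,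
                     (λ b>0 → [ bc b>0 , bd b>0 ]′ (pos-+ c+d>0)) ]′ (pos-+ a+b>0))

forces-exclusive : ∀ l {c x c′ y} → Distinct l → ¬ SamePair c x c′ y →
  Exclusive (forces c x l) (forces c′ y l)
forces-exclusive l {c} {x} {c′} {y} d ¬same p q =
  ¬same (spans-unique l (forces-spans c x l d p) (forces-spans c′ y l d q))

forces-exclusive₂ : ∀ l {c x c′ y} → Distinct l → ¬ SamePair c x c′ y →
  forces c x l + forces c′ y l ≤ 1
forces-exclusive₂ l {c} {x} {c′} {y} d ¬same =
  exclusive₂ (forces-≤1 c x l) (forces-≤1 c′ y l) (forces-exclusive l d ¬same)

forces-exclusive₄ : ∀ l {c₁ x₁ c₂ x₂ c₃ x₃ c₄ x₄} → Distinct l →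
  ¬ SamePair c₁ x₁ c₂ x₂ → ¬ SamePair c₁ x₁ c₃ x₃ → ¬ SamePair c₁ x₁ c₄ x₄ →
  ¬ SamePair c₂ x₂ c₃ x₃ → ¬ SamePair c₂ x₂ c₄ x₄ → ¬ SamePair c₃ x₃ c₄ x₄ →
  (forces c₁ x₁ l + forces c₂ x₂ l) + (forces c₃ x₃ l + forces c₄ x₄ l) ≤ 1
forces-exclusive₄ l {c₁} {x₁} {c₂} {x₂} {c₃} {x₃} {c₄} {x₄} d s₁₂ s₁₃ s₁₄ s₂₃ s₂₄ s₃₄ =
  exclusive₄ (forces-≤1 c₁ x₁ l) (forces-≤1 c₂ x₂ l) (forces-≤1 c₃ x₃ l) (forces-≤1 c₄ x₄ l)
    (forces-exclusive l d s₁₂) (forces-exclusive l d s₁₃) (forces-exclusive l d s₁₄)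
    (forces-exclusive l d s₂₃) (forces-exclusive l d s₂₄) (forces-exclusive l d s₃₄)

forces-on-list : ∀ c x l → Distinct l → 0 < forces c x l → ∃ λ k → lookup l k ≡ x
forces-on-list c x (u ∷ w ∷ []) u≢w pos with forces-spans c x (u ∷ w ∷ []) u≢w pos
... | inj₁ (_ , w≡x) = 1F , w≡x
... | inj₂ (_ , u≡x) = 0F , u≡x

forces-self : ∀ c l → Distinct l → forces c c l ≤ 0
forces-self c (u ∷ w ∷ []) u≢w = ≮⇒≥ λ pos →
  [ (λ (u≡c , w≡c) → u≢w (trans u≡c (sym w≡c))) , (λ (w≡c , u≡c) → u≢w (trans u≡c (sym w≡c))) ]′
  (forces-spans c c (u ∷ w ∷ []) u≢w pos)

-- Counts of forced leaves in a star whose leaves carry the distinct two-colour lists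
-- `lists`: forced c x is the number of leaves with list {c, x}.
module ForcedLeaves {m : ℕ} (lists : Fin m → Vec Colour 2) (distinct : ∀ i → Distinct (lists i)) where

  forced : Colour → Colour → ℕ
  forced c x = sum (λ i → forces c x (lists i))

  forced-≤ : ∀ c x → forced c x ≤ m
  forced-≤ c x = subst (forced c x ≤_) (*-identityʳ m)
    (sum-bound (λ i → forces c x (lists i)) (λ i → forces-≤1 c x (lists i)))

  forced-self : ∀ c → forced c c ≡ 0
  forced-self c = n≤0⇒n≡0 (subst (forced c c ≤_) (*-zeroʳ m)
    (sum-bound (λ i → forces c c (lists i)) (λ i → forces-self c (lists i) (distinct i))))

  -- Leaves with different lists are different leaves.
  forced-exclusive₂ : ∀ {c x c′ y} → ¬ SamePair c x c′ y → forced c x + forced c′ y ≤ m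
  forced-exclusive₂ {c} {x} {c′} {y} ¬same = begin
    forced c x + forced c′ y  ≡⟨ sym (∑-distrib-+ f g) ⟩
    sum (λ i → f i + g i)     ≤⟨ sum-bound _ (λ i → forces-exclusive₂ (lists i) (distinct i) ¬same) ⟩
    m * 1                     ≡⟨ *-identityʳ m ⟩
    m                         ∎
    where
    open ≤-Reasoning
    f g : Fin m → ℕ
    f i = forces c x (lists i)
    g i = forces c′ y (lists i)

  forced-exclusive₄ : ∀ {c₁ x₁ c₂ x₂ c₃ x₃ c₄ x₄} →
    ¬ SamePair c₁ x₁ c₂ x₂ → ¬ SamePair c₁ x₁ c₃ x₃ → ¬ SamePair c₁ x₁ c₄ x₄ →
    ¬ SamePair c₂ x₂ c₃ x₃ → ¬ SamePair c₂ x₂ c₄ x₄ → ¬ SamePair c₃ x₃ c₄ x₄ →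
    (forced c₁ x₁ + forced c₂ x₂) + (forced c₃ x₃ + forced c₄ x₄) ≤ m
  forced-exclusive₄ {c₁} {x₁} {c₂} {x₂} {c₃} {x₃} {c₄} {x₄} s₁₂ s₁₃ s₁₄ s₂₃ s₂₄ s₃₄ = begin
    (sum f₁ + sum f₂) + (sum f₃ + sum f₄)
      ≡⟨ sym (cong₂ _+_ (∑-distrib-+ f₁ f₂) (∑-distrib-+ f₃ f₄)) ⟩
    sum (λ i → f₁ i + f₂ i) + sum (λ i → f₃ i + f₄ i)
      ≡⟨ sym (∑-distrib-+ (λ i → f₁ i + f₂ i) (λ i → f₃ i + f₄ i)) ⟩
    sum (λ i → (f₁ i + f₂ i) + (f₃ i + f₄ i))
      ≤⟨ sum-bound _ (λ i → forces-exclusive₄ (lists i) (distinct i) s₁₂ s₁₃ s₁₄ s₂₃ s₂₄ s₃₄) ⟩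
    m * 1
      ≡⟨ *-identityʳ m ⟩
    m ∎
    where
    open ≤-Reasoning
    f₁ f₂ f₃ f₄ : Fin m → ℕ
    f₁ i = forces c₁ x₁ (lists i)
    f₂ i = forces c₂ x₂ (lists i)
    f₃ i = forces c₃ x₃ (lists i)
    f₄ i = forces c₄ x₄ (lists i)

  forced-on-list : ∀ c x → 0 < forced c x → ∃₂ λ i k → lookup (lists i) k ≡ x
  forced-on-list c x pos with sum-pos (λ i → forces c x (lists i)) pos
  ... | i , forced-i = i , forces-on-list c x (lists i) (distinct i) forced-i

-- Numerical conditions, for stars with m₁ and m₂ leaves and colour-class bound t, under
-- which the counting argument below succeeds: each star alone fits below t, and two
-- (respectively four) overloaded colours would need more leaves than there are.
record CountingBounds (m₁ m₂ t : ℕ) : Set where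
  field
    m₁≤t             : m₁ ≤ t
    m₂≤t             : m₂ ≤ t
    two-bad-bound    : m₁ + m₂ < suc t + suc t
    four-bad-bound₁  : ((m₁ + m₁) + (m₁ + m₁)) + m₂ < (suc t + suc t) + (suc t + suc t)
    four-bad-bound₂  : m₁ + ((m₂ + m₂) + (m₂ + m₂)) < (suc t + suc t) + (suc t + suc t)
    four-bad-bound₁₂ : (m₁ + m₁) + (m₂ + m₂) < (suc t + suc t) + (suc t + suc t)

-- Once the centres are coloured c and d, the
-- leaves of star 1 with list {c, x} and of star 2 with list {d, x} are forced to x;
-- the pair (c, d) is good when no colour is forced on more than t leaves.
module CentreChoice {m₁ m₂ t : ℕ} (bounds : CountingBounds m₁ m₂ t)
  (lists₁ : Fin m₁ → Vec Colour 2) (distinct₁ : ∀ i → Distinct (lists₁ i))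
  (lists₂ : Fin m₂ → Vec Colour 2) (distinct₂ : ∀ j → Distinct (lists₂ j)) where

  open CountingBounds bounds
  module Star₁ = ForcedLeaves lists₁ distinct₁
  module Star₂ = ForcedLeaves lists₂ distinct₂
  open Star₁ public using () renaming (forced to forced₁)
  open Star₂ public using () renaming (forced to forced₂)

  load : Colour → Colour → Colour → ℕ
  load c d x = forced₁ c x + forced₂ d x

  Bad : Colour → Colour → Colour → Set
  Bad c d x = t < load c d x

  Good : Colour → Colour → Set
  Good c d = ∀ x → load c d x ≤ t

  -- A bad colour differs from both centre colours, since one star alone fits below t.
  bad≢centre₁ : ∀ {c d x} → Bad c d x → x ≢ c
  bad≢centre₁ {c} {d} bad refl = <⇒≱ bad (begin
    forced₁ c c + forced₂ d c  ≡⟨ cong (_+ forced₂ d c) (Star₁.forced-self c) ⟩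
    forced₂ d c                ≤⟨ Star₂.forced-≤ d c ⟩
    m₂                         ≤⟨ m₂≤t ⟩
    t                          ∎)
    where open ≤-Reasoning

  bad≢centre₂ : ∀ {c d x} → Bad c d x → x ≢ d
  bad≢centre₂ {c} {d} bad refl = <⇒≱ bad (begin
    forced₁ c d + forced₂ d d  ≡⟨ cong (forced₁ c d +_) (Star₂.forced-self d) ⟩
    forced₁ c d + 0            ≡⟨ +-identityʳ _ ⟩
    forced₁ c d                ≤⟨ Star₁.forced-≤ c d ⟩
    m₁                         ≤⟨ m₁≤t ⟩
    t                          ∎)
    where open ≤-Reasoning

  two-bad-load : ∀ {c d x c′ d′ y} → Bad c d x → Bad c′ d′ y →
    suc t + suc t ≤ (forced₁ c x + forced₁ c′ y) + (forced₂ d x + forced₂ d′ y)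
  two-bad-load {c} {d} {x} {c′} {d′} {y} b b′ = begin
    suc t + suc t  ≤⟨ +-mono-≤ b b′ ⟩
    (forced₁ c x + forced₂ d x) + (forced₁ c′ y + forced₂ d′ y)
      ≡⟨ interchange (forced₁ c x) (forced₂ d x) (forced₁ c′ y) (forced₂ d′ y) ⟩
    (forced₁ c x + forced₁ c′ y) + (forced₂ d x + forced₂ d′ y) ∎
    where open ≤-Reasoning

  four-bad-load : ∀ {c₁ d₁ x₁ c₂ d₂ x₂ c₃ d₃ x₃ c₄ d₄ x₄} →
    Bad c₁ d₁ x₁ → Bad c₂ d₂ x₂ → Bad c₃ d₃ x₃ → Bad c₄ d₄ x₄ →
    (suc t + suc t) + (suc t + suc t) ≤
      ((forced₁ c₁ x₁ + forced₁ c₂ x₂) + (forced₁ c₃ x₃ + forced₁ c₄ x₄)) +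
      ((forced₂ d₁ x₁ + forced₂ d₂ x₂) + (forced₂ d₃ x₃ + forced₂ d₄ x₄))
  four-bad-load {c₁} {d₁} {x₁} {c₂} {d₂} {x₂} {c₃} {d₃} {x₃} {c₄} {d₄} {x₄} b₁ b₂ b₃ b₄ = begin
    (suc t + suc t) + (suc t + suc t)     ≤⟨ +-mono-≤ (two-bad-load b₁ b₂) (two-bad-load b₃ b₄) ⟩
    (A₁₂ + B₁₂) + (A₃₄ + B₃₄)             ≡⟨ interchange A₁₂ B₁₂ A₃₄ B₃₄ ⟩
    (A₁₂ + A₃₄) + (B₁₂ + B₃₄)             ∎
    where
    open ≤-Reasoning
    A₁₂ A₃₄ B₁₂ B₃₄ : ℕ
    A₁₂ = forced₁ c₁ x₁ + forced₁ c₂ x₂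
    A₃₄ = forced₁ c₃ x₃ + forced₁ c₄ x₄
    B₁₂ = forced₂ d₁ x₁ + forced₂ d₂ x₂
    B₃₄ = forced₂ d₃ x₃ + forced₂ d₄ x₄

  -- Two bad choices that differ at both centres use each other's centre colours, on
  -- star 1 or on star 2; otherwise their forced leaves would be 2(t + 1) > m₁ + m₂ leaves.
  two-bad : ∀ {c d x c′ d′ y} → Bad c d x → Bad c′ d′ y → c ≢ c′ → d ≢ d′ →
    (x ≡ c′ × y ≡ c) ⊎ (x ≡ d′ × y ≡ d)
  two-bad {c} {d} {x} {c′} {d′} {y} b b′ c≢c′ d≢d′
    with (x ≟ c′) ×-dec (y ≟ c) | (x ≟ d′) ×-dec (y ≟ d)
  ... | yes swap₁ | _         = inj₁ swap₁
  ... | no _      | yes swap₂ = inj₂ swap₂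
  ... | no ¬swap₁ | no ¬swap₂ = ⊥-elim (<⇒≱ two-bad-bound (≤-trans (two-bad-load b b′)
          (+-mono-≤ (Star₁.forced-exclusive₂ (¬cross c≢c′ ¬swap₁))
                    (Star₂.forced-exclusive₂ (¬cross d≢d′ ¬swap₂)))))

  -- The three ways four bad choices could pair up (p, q: the list of centre 1;
  -- r, s: the list of centre 2); each overloads the leaves.
  -- (i) Every bad colour is the other colour of list 1.
  ¬bad-from-list₁ : ∀ {p q r s} → p ≢ q → r ≢ s →
    Bad p r q → Bad p s q → Bad q r p → Bad q s p → ⊥
  ¬bad-from-list₁ {p} {q} {r} {s} p≢q r≢s b₁ b₂ b₃ b₄ =
    <⇒≱ four-bad-bound₁ (≤-trans (four-bad-load b₁ b₂ b₃ b₄) (+-mono-≤ star₁ star₂))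
    where
    star₁ : (forced₁ p q + forced₁ p q) + (forced₁ q p + forced₁ q p) ≤ (m₁ + m₁) + (m₁ + m₁)
    star₁ = +-mono-≤ (+-mono-≤ (Star₁.forced-≤ p q) (Star₁.forced-≤ p q))
                     (+-mono-≤ (Star₁.forced-≤ q p) (Star₁.forced-≤ q p))
    q≢r : q ≢ r
    q≢r = bad≢centre₂ b₁
    q≢s : q ≢ s
    q≢s = bad≢centre₂ b₂
    p≢s : p ≢ s
    p≢s = bad≢centre₂ b₄
    star₂ : (forced₂ r q + forced₂ s q) + (forced₂ r p + forced₂ s p) ≤ m₂
    star₂ = Star₂.forced-exclusive₄
      (¬cross r≢s (q≢s ∘ proj₁)) (¬same-centre (≢-sym p≢q)) (¬cross r≢s (q≢s ∘ proj₁))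
      (¬cross (≢-sym r≢s) (q≢r ∘ proj₁)) (¬same-centre (≢-sym p≢q)) (¬cross r≢s (p≢s ∘ proj₁))

  -- (ii) Every bad colour is the other colour of list 2.
  ¬bad-from-list₂ : ∀ {p q r s} → p ≢ q → r ≢ s →
    Bad p r s → Bad p s r → Bad q r s → Bad q s r → ⊥
  ¬bad-from-list₂ {p} {q} {r} {s} p≢q r≢s b₁ b₂ b₃ b₄ =
    <⇒≱ four-bad-bound₂ (≤-trans (four-bad-load b₁ b₂ b₃ b₄) (+-mono-≤ star₁ star₂))
    where
    s≢q : s ≢ q
    s≢q = bad≢centre₁ b₃
    r≢q : r ≢ q
    r≢q = bad≢centre₁ b₄
    star₁ : (forced₁ p s + forced₁ p r) + (forced₁ q s + forced₁ q r) ≤ m₁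
    star₁ = Star₁.forced-exclusive₄
      (¬same-centre (≢-sym r≢s)) (¬cross p≢q (s≢q ∘ proj₁)) (¬cross p≢q (s≢q ∘ proj₁))
      (¬cross p≢q (r≢q ∘ proj₁)) (¬cross p≢q (r≢q ∘ proj₁)) (¬same-centre (≢-sym r≢s))
    star₂ : (forced₂ r s + forced₂ s r) + (forced₂ r s + forced₂ s r) ≤ (m₂ + m₂) + (m₂ + m₂)
    star₂ = +-mono-≤ (+-mono-≤ (Star₂.forced-≤ r s) (Star₂.forced-≤ s r))
                     (+-mono-≤ (Star₂.forced-≤ r s) (Star₂.forced-≤ s r))

  -- (iii) Two bad colours come from each list.
  ¬bad-mixed : ∀ {p q r s} → p ≢ q → r ≢ s →
    Bad p r q → Bad p s r → Bad q r s → Bad q s p → ⊥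
  ¬bad-mixed {p} {q} {r} {s} p≢q r≢s b₁ b₂ b₃ b₄ =
    <⇒≱ four-bad-bound₁₂ (≤-trans (four-bad-load b₁ b₂ b₃ b₄) (+-mono-≤ star₁ star₂))
    where
    q≢r : q ≢ r
    q≢r = bad≢centre₂ b₁
    p≢s : p ≢ s
    p≢s = bad≢centre₂ b₄
    q≢s : q ≢ s
    q≢s = ≢-sym (bad≢centre₁ b₃)
    p≢r : p ≢ r
    p≢r = ≢-sym (bad≢centre₁ b₂)
    star₁ : (forced₁ p q + forced₁ p r) + (forced₁ q s + forced₁ q p) ≤ m₁ + m₁
    star₁ = +-mono-≤ (Star₁.forced-exclusive₂ (¬same-centre q≢r))
                     (Star₁.forced-exclusive₂ (¬same-centre (≢-sym p≢s)))
    star₂ : (forced₂ r q + forced₂ s r) + (forced₂ r s + forced₂ s p) ≤ m₂ + m₂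
    star₂ = +-mono-≤ (Star₂.forced-exclusive₂ (¬cross r≢s (q≢s ∘ proj₁)))
                     (Star₂.forced-exclusive₂ (¬cross r≢s (p≢r ∘ proj₂)))

  -- The four choices of centre colours cannot all be bad: pairing the diagonally
  -- opposite choices with two-bad leaves only the three configurations above.
  ¬all-bad : ∀ {p q r s x₁ x₂ x₃ x₄} → p ≢ q → r ≢ s →
    Bad p r x₁ → Bad p s x₂ → Bad q r x₃ → Bad q s x₄ → ⊥
  ¬all-bad p≢q r≢s b₁ b₂ b₃ b₄ with two-bad b₁ b₄ p≢q r≢s | two-bad b₂ b₃ p≢q (≢-sym r≢s)
  ... | inj₁ (refl , refl) | inj₁ (refl , refl) = ¬bad-from-list₁ p≢q r≢s b₁ b₂ b₃ b₄
  ... | inj₂ (refl , refl) | inj₂ (refl , refl) = ¬bad-from-list₂ p≢q r≢s b₁ b₂ b₃ b₄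
  ... | inj₁ (refl , refl) | inj₂ (refl , refl) = ¬bad-mixed p≢q r≢s b₁ b₂ b₃ b₄
  ... | inj₂ (refl , refl) | inj₁ (refl , refl) = ¬bad-mixed p≢q (≢-sym r≢s) b₂ b₁ b₄ b₃

  bad-on-list : ∀ {c d x} → Bad c d x →
    (∃₂ λ i k → lookup (lists₁ i) k ≡ x) ⊎ (∃₂ λ j k → lookup (lists₂ j) k ≡ x)
  bad-on-list {c} {d} {x} bad =
    ⊎-map (Star₁.forced-on-list c x) (Star₂.forced-on-list d x) (pos-+ (≤-trans (s≤s z≤n) bad))

  -- Goodness is decidable: only the finitely many colours on leaf lists can be bad.
  good-or-bad : ∀ c d → Good c d ⊎ ∃ (Bad c d)
  good-or-bad c d with any? (λ i → any? (λ k → t <? load c d (lookup (lists₁ i) k)))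
                     | any? (λ j → any? (λ k → t <? load c d (lookup (lists₂ j) k)))
  ... | yes (_ , _ , bad) | _                 = inj₂ (_ , bad)
  ... | no _              | yes (_ , _ , bad) = inj₂ (_ , bad)
  ... | no none₁          | no none₂          = inj₁ (λ x → ≮⇒≥ (λ bad →
    [ (λ (i , k , on-list) → none₁ (i , k , subst (Bad c d) (sym on-list) bad)) ,
      (λ (j , k , on-list) → none₂ (j , k , subst (Bad c d) (sym on-list) bad)) ]′ (bad-on-list bad)))

  choose-centres : ∀ (ℓ₁ ℓ₂ : Vec Colour 2) → Distinct ℓ₁ → Distinct ℓ₂ →
    ∃₂ λ c d → c ∈ ℓ₁ × d ∈ ℓ₂ × Good c d
  choose-centres (p ∷ q ∷ []) (r ∷ s ∷ []) p≢q r≢s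
    with good-or-bad p r | good-or-bad p s | good-or-bad q r | good-or-bad q s
  ... | inj₁ good | _         | _         | _         = p , r , here refl , here refl , good
  ... | inj₂ _    | inj₁ good | _         | _         = p , s , here refl , there (here refl) , good
  ... | inj₂ _    | inj₂ _    | inj₁ good | _         = q , r , there (here refl) , here refl , good
  ... | inj₂ _    | inj₂ _    | inj₂ _    | inj₁ good =
    q , s , there (here refl) , there (here refl) , good
  ... | inj₂ (_ , b₁) | inj₂ (_ , b₂) | inj₂ (_ , b₃) | inj₂ (_ , b₄) =
    ⊥-elim (¬all-bad p≢q r≢s b₁ b₂ b₃ b₄)

-- The graph Star m₁ ⊕ Star m₂.  Vertex v lies in part v, which is inj₁ i (vertex i of
-- star 1, vertex 0 being its centre) or inj₂ j (vertex j of star 2).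
module TwoStars (m₁ m₂ : ℕ) where

  G : Graph
  G = Star m₁ ⊕ Star m₂

  N : ℕ
  N = suc m₁ + suc m₂

  Part : Set
  Part = Fin (suc m₁) ⊎ Fin (suc m₂)

  part : Fin N → Part
  part = splitAt (suc m₁)

  centre₁ centre₂ : Fin N
  centre₁ = zero
  centre₂ = suc m₁ ↑ʳ zero

  leaf₁ : Fin m₁ → Fin N
  leaf₁ i = suc i ↑ˡ suc m₂

  leaf₂ : Fin m₂ → Fin N
  leaf₂ j = suc m₁ ↑ʳ suc j

  sum-parts : (H : Part → Fin N → ℕ) → sum (λ v → H (part v) v) ≡
    sum (λ i → H (inj₁ i) (i ↑ˡ suc m₂)) + sum (λ j → H (inj₂ j) (suc m₁ ↑ʳ j))
  sum-parts H = trans (sum-++ (suc m₁) (λ v → H (part v) v)) (cong₂ _+_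
    (sum-cong-≗ (λ i → cong (λ z → H z (i ↑ˡ suc m₂)) (splitAt-↑ˡ (suc m₁) i (suc m₂))))
    (sum-cong-≗ (λ j → cong (λ z → H z (suc m₁ ↑ʳ j)) (splitAt-↑ʳ (suc m₁) (suc m₂) j))))

  part-centre₁ : ∀ {v} → part v ≡ inj₁ zero → v ≡ centre₁
  part-centre₁ {v} eq =
    trans (sym (join-splitAt (suc m₁) (suc m₂) v)) (cong (join (suc m₁) (suc m₂)) eq)

  part-centre₂ : ∀ {v} → part v ≡ inj₂ zero → v ≡ centre₂
  part-centre₂ {v} eq =
    trans (sym (join-splitAt (suc m₁) (suc m₂) v)) (cong (join (suc m₁) (suc m₂)) eq)

  data CentreLeaf (u v : Fin N) : Set where
    star₁ : part u ≡ inj₁ zero → ∀ i → part v ≡ inj₁ (suc i) → CentreLeaf u v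
    star₂ : part u ≡ inj₂ zero → ∀ j → part v ≡ inj₂ (suc j) → CentreLeaf u v

  edge-shape : ∀ u v → Adj G u v → CentreLeaf u v ⊎ CentreLeaf v u
  edge-shape u v adj with splitAt (suc m₁) u in eu | splitAt (suc m₁) v in ev
  ... | inj₁ zero    | inj₁ zero    = ⊥-elim ([ (λ (_ , n) → n refl) , (λ (_ , n) → n refl) ]′ adj)
  ... | inj₁ zero    | inj₁ (suc i) = inj₁ (star₁ eu i ev)
  ... | inj₁ (suc i) | inj₁ zero    = inj₂ (star₁ ev i eu)
  ... | inj₁ (suc _) | inj₁ (suc _) = ⊥-elim ([ (λ { (() , _) }) , (λ { (() , _) }) ]′ adj)
  ... | inj₂ zero    | inj₂ zero    = ⊥-elim ([ (λ (_ , n) → n refl) , (λ (_ , n) → n refl) ]′ adj)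
  ... | inj₂ zero    | inj₂ (suc j) = inj₁ (star₂ eu j ev)
  ... | inj₂ (suc j) | inj₂ zero    = inj₂ (star₂ ev j eu)
  ... | inj₂ (suc _) | inj₂ (suc _) = ⊥-elim ([ (λ { (() , _) }) , (λ { (() , _) }) ]′ adj)
  ... | inj₁ _       | inj₂ _       = ⊥-elim adj
  ... | inj₂ _       | inj₁ _       = ⊥-elim adj

  adj₁ : ∀ i → Adj G centre₁ (leaf₁ i)
  adj₁ i rewrite splitAt-↑ˡ (suc m₁) (suc i) (suc m₂) = inj₁ (refl , λ ())

  adj₂ : ∀ j → Adj G centre₂ (leaf₂ j)
  adj₂ j rewrite splitAt-↑ʳ (suc m₁) (suc m₂) zero | splitAt-↑ʳ (suc m₁) (suc m₂) (suc j) =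
    inj₁ (refl , λ ())

  assignment : (ℓ : Part → Vec Colour 2) → (∀ z → Distinct (ℓ z)) → Assignment G 2
  assignment ℓ d = record
    { lists = ℓ ∘ part ; distinct = λ v → distinct⇒injective {ℓ (part v)} (d (part v)) }

-- The numerical conditions for the upper bound, with t = ⌈N/2⌉: the counting bounds;
-- room in one colour class for both centres, or for one centre together with the other
-- star; and a total budget 2t ≥ N for the greedy choice.
record Feasible (m₁ m₂ t : ℕ) : Set where
  field
    counting : CountingBounds m₁ m₂ t
    two≤t    : 2 ≤ t
    m₁<t     : m₁ < t
    m₂<t     : m₂ < t
    N≤2t     : suc m₁ + suc m₂ ≤ t + t

-- Colour the centres by a good pair c₁, c₂; the leaves forced by them take
-- their forced colour, and the greedy choice distributes the free leaves.
module UpperBound {m₁ m₂ : ℕ} (feasible : Feasible m₁ m₂ ⌈ suc m₁ + suc m₂ / 2 ⌉)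
  (L : Assignment (Star m₁ ⊕ Star m₂) 2) where

  open TwoStars m₁ m₂
  open Feasible feasible

  t : ℕ
  t = ⌈ N / 2 ⌉

  distinct-at : ∀ v → Distinct (lists L v)
  distinct-at v = injective⇒distinct {lists L v} (distinct L v)

  open CentreChoice counting
    (lists L ∘ leaf₁) (distinct-at ∘ leaf₁) (lists L ∘ leaf₂) (distinct-at ∘ leaf₂)

  module Colouring {c₁ c₂ : Colour} (c₁∈ : c₁ ∈ lists L centre₁) (c₂∈ : c₂ ∈ lists L centre₂)
    (good : Good c₁ c₂) where

    optionsAt : Part → Vec Colour 2 → Options
    optionsAt (inj₁ zero)    _ = c₁ , c₁
    optionsAt (inj₁ (suc _)) ℓ = leafOptions c₁ ℓ
    optionsAt (inj₂ zero)    _ = c₂ , c₂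
    optionsAt (inj₂ (suc _)) ℓ = leafOptions c₂ ℓ

    options : Fin N → Options
    options v = optionsAt (part v) (lists L v)

    centres-and-leaves : ∀ c → (χ (c₁ ≟ c) + forced₁ c₁ c) + (χ (c₂ ≟ c) + forced₂ c₂ c) ≤ t
    centres-and-leaves c with c₁ ≟ c | c₂ ≟ c
    ... | yes refl | yes refl = subst₂ (λ a b → (1 + a) + (1 + b) ≤ t)
                                  (sym (Star₁.forced-self c)) (sym (Star₂.forced-self c)) two≤t
    ... | yes refl | no _     = begin
      (1 + forced₁ c c) + forced₂ c₂ c  ≡⟨ cong (λ a → suc a + forced₂ c₂ c) (Star₁.forced-self c) ⟩
      suc (forced₂ c₂ c)                ≤⟨ s≤s (Star₂.forced-≤ c₂ c) ⟩
      suc m₂                            ≤⟨ m₂<t ⟩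
      t                                 ∎
      where open ≤-Reasoning
    ... | no _     | yes refl = begin
      forced₁ c₁ c + (1 + forced₂ c c)  ≡⟨ cong (λ b → forced₁ c₁ c + suc b) (Star₂.forced-self c) ⟩
      forced₁ c₁ c + 1                  ≡⟨ +-comm (forced₁ c₁ c) 1 ⟩
      suc (forced₁ c₁ c)                ≤⟨ s≤s (Star₁.forced-≤ c₁ c) ⟩
      suc m₁                            ≤⟨ m₁<t ⟩
      t                                 ∎
      where open ≤-Reasoning
    ... | no _     | no _     = good c

    forced-within : ∀ c → sum (λ v → forcedAt (options v) c) ≤ t
    forced-within c = begin
      sum (λ v → forcedAt (options v) c)
        ≡⟨ sum-parts (λ z v → forcedAt (optionsAt z (lists L v)) c) ⟩
      (forcedAt (c₁ , c₁) c + forced₁ c₁ c) + (forcedAt (c₂ , c₂) c + forced₂ c₂ c)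
        ≡⟨ cong₂ (λ a b → (a + forced₁ c₁ c) + (b + forced₂ c₂ c))
                 (forcedAt-diag {c₁} c refl) (forcedAt-diag {c₂} c refl) ⟩
      (χ (c₁ ≟ c) + forced₁ c₁ c) + (χ (c₂ ≟ c) + forced₂ c₂ c)
        ≤⟨ centres-and-leaves c ⟩
      t ∎
      where open ≤-Reasoning

    choice-made : Choice N options (λ _ → t)
    choice-made = greedy N options (λ _ → t) forced-within (λ _ _ _ → N≤2t)

    colouring : Fin N → Colour
    colouring = Choice.colour choice-made

    chosen-at : ∀ {v z} → part v ≡ z → colouring v ∈ₒ optionsAt z (lists L v)
    chosen-at {v} eq =
      subst (λ z → colouring v ∈ₒ optionsAt z (lists L v)) eq (Choice.chosen choice-made v)

    in-list : ∀ v → colouring v ∈ lists L v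
    in-list v with part v in eq
    ... | inj₁ zero    =
      subst₂ (λ x w → x ∈ lists L w) (sym (∈ₒ-diag (chosen-at eq))) (sym (part-centre₁ eq)) c₁∈
    ... | inj₁ (suc _) = leafOptions-∈ c₁ (lists L v) (chosen-at eq)
    ... | inj₂ zero    =
      subst₂ (λ x w → x ∈ lists L w) (sym (∈ₒ-diag (chosen-at eq))) (sym (part-centre₂ eq)) c₂∈
    ... | inj₂ (suc _) = leafOptions-∈ c₂ (lists L v) (chosen-at eq)

    centre-leaf-differ : ∀ {u v} → CentreLeaf u v → colouring u ≢ colouring v
    centre-leaf-differ {v = v} (star₁ pu _ pv) cu≡cv = leafOptions-avoid c₁ (lists L v)
      (distinct-at v) (chosen-at pv) (trans (sym cu≡cv) (∈ₒ-diag (chosen-at pu)))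
    centre-leaf-differ {v = v} (star₂ pu _ pv) cu≡cv = leafOptions-avoid c₂ (lists L v)
      (distinct-at v) (chosen-at pv) (trans (sym cu≡cv) (∈ₒ-diag (chosen-at pu)))

    proper : ∀ u v → Adj G u v → colouring u ≢ colouring v
    proper u v adj =
      [ centre-leaf-differ , (λ vu → ≢-sym (centre-leaf-differ vu)) ]′ (edge-shape u v adj)

    equitable : IsEquitableLColouring G 2 L colouring
    equitable = (in-list , proper) , λ c →
      subst (_≤ t) (sym (colourClassSize≡count G colouring c)) (Choice.within choice-made c)

  equitable-colouring : ∃ (IsEquitableLColouring G 2 L)
  equitable-colouring
    with choose-centres (lists L centre₁) (lists L centre₂) (distinct-at centre₁) (distinct-at centre₂)
  ... | _ , _ , c₁∈ , c₂∈ , good = Colouring.colouring c₁∈ c₂∈ good , Colouring.equitable c₁∈ c₂∈ good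

equitably-choosable : ∀ {m₁ m₂} → Feasible m₁ m₂ ⌈ suc m₁ + suc m₂ / 2 ⌉ →
  EquitablyChoosable (Star m₁ ⊕ Star m₂) 2
equitably-choosable feasible L = UpperBound.equitable-colouring feasible L

feasible : ∀ m₁ m₂ → let t = ⌈ suc m₁ + suc m₂ / 2 ⌉ in
  {_ : True (m₁ + m₂ <? suc t + suc t)} →
  {_ : True (((m₁ + m₁) + (m₁ + m₁)) + m₂ <? (suc t + suc t) + (suc t + suc t))} →
  {_ : True (m₁ + ((m₂ + m₂) + (m₂ + m₂)) <? (suc t + suc t) + (suc t + suc t))} →
  {_ : True ((m₁ + m₁) + (m₂ + m₂) <? (suc t + suc t) + (suc t + suc t))} →
  {_ : True (2 ≤? t)} → {_ : True (m₁ <? t)} → {_ : True (m₂ <? t)} →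
  {_ : True (suc m₁ + suc m₂ ≤? t + t)} →
  Feasible m₁ m₂ t
feasible m₁ m₂ {two} {four₁} {four₂} {four₁₂} {two≤t} {m₁<t} {m₂<t} {N≤2t} = record
  { counting = record
    { m₁≤t = <⇒≤ (toWitness m₁<t) ; m₂≤t = <⇒≤ (toWitness m₂<t)
    ; two-bad-bound = toWitness two ; four-bad-bound₁ = toWitness four₁
    ; four-bad-bound₂ = toWitness four₂ ; four-bad-bound₁₂ = toWitness four₁₂ }
  ; two≤t = toWitness two≤t ; m₁<t = toWitness m₁<t ; m₂<t = toWitness m₂<t
  ; N≤2t = toWitness N≤2t }

feasible-cases : ∀ {m₁ d} → 1 ≤ m₁ → m₁ ≤ 7 → d ≤ 1 →
  Feasible m₁ (m₁ + d) ⌈ suc m₁ + suc (m₁ + d) / 2 ⌉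
feasible-cases {1} {0} _ _ _ = feasible 1 1
feasible-cases {1} {1} _ _ _ = feasible 1 2
feasible-cases {2} {0} _ _ _ = feasible 2 2
feasible-cases {2} {1} _ _ _ = feasible 2 3
feasible-cases {3} {0} _ _ _ = feasible 3 3
feasible-cases {3} {1} _ _ _ = feasible 3 4
feasible-cases {4} {0} _ _ _ = feasible 4 4
feasible-cases {4} {1} _ _ _ = feasible 4 5
feasible-cases {5} {0} _ _ _ = feasible 5 5
feasible-cases {5} {1} _ _ _ = feasible 5 6
feasible-cases {6} {0} _ _ _ = feasible 6 6
feasible-cases {6} {1} _ _ _ = feasible 6 7
feasible-cases {7} {0} _ _ _ = feasible 7 7
feasible-cases {7} {1} _ _ _ = feasible 7 8
feasible-cases {0} () _ _
feasible-cases {suc _} {suc (suc _)} _ _ (s≤s ())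
feasible-cases {suc (suc (suc (suc (suc (suc (suc (suc _)))))))} _
  (s≤s (s≤s (s≤s (s≤s (s≤s (s≤s (s≤s ()))))))) _

⌈/2⌉-≤ : ∀ {n k} → n ≤ k + k → ⌈ n / 2 ⌉ ≤ k
⌈/2⌉-≤ {n} {k} n≤2k = ≤-pred (m<n*o⇒m/o<n {n + 1} {suc k} {2} (begin-strict
  n + 1            ≤⟨ +-monoˡ-≤ 1 n≤2k ⟩
  k + k + 1        <⟨ n<1+n _ ⟩
  suc (k + k + 1)  ≡⟨ double k ⟩
  suc k * 2        ∎))
  where
  open ≤-Reasoning
  double : ∀ k → suc (k + k + 1) ≡ suc k * 2
  double = solve-∀

data Flip : Colour → Colour → Set where
  0↔1 : Flip 0 1
  1↔0 : Flip 1 0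

flip-sym : ∀ {y y′} → Flip y y′ → Flip y′ y
flip-sym 0↔1 = 1↔0
flip-sym 1↔0 = 0↔1

flip-of : ∀ {x} → x ∈ (0 ∷ 1 ∷ []) → ∃ (Flip x)
flip-of (here refl)         = 1 , 0↔1
flip-of (there (here refl)) = 0 , 1↔0

flip-other : ∀ {x y y′} → Flip y y′ → x ∈ (0 ∷ 1 ∷ []) → x ≢ y → x ≡ y′
flip-other 0↔1 x∈ x≢0 = the-other x∈ x≢0
flip-other 1↔0 x∈ x≢1 = [ id , (λ x≡1 → ⊥-elim (x≢1 x≡1)) ]′ (∈-pair x∈)

-- In a proper colouring the centre of star 2 takes a colour y and its m₂
-- leaves the other colour y′, so equitability leaves room for at most t ∸ m₂
-- vertices of colour y′ in star 1.
module LowerBound {m₁ m₂ : ℕ} (list₁ : Fin (suc m₁) → Vec Colour 2)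
  (distinct₁ : ∀ i → Distinct (list₁ i)) where

  open TwoStars m₁ m₂

  t : ℕ
  t = ⌈ N / 2 ⌉

  list-of : Part → Vec Colour 2
  list-of (inj₁ i) = list₁ i
  list-of (inj₂ _) = 0 ∷ 1 ∷ []

  list-of-distinct : ∀ z → Distinct (list-of z)
  list-of-distinct (inj₁ i) = distinct₁ i
  list-of-distinct (inj₂ _) = λ ()

  L : Assignment G 2
  L = assignment list-of list-of-distinct

  module _ {f : Fin N → Colour} (equitable : IsEquitableLColouring G 2 L f) where

    differ : ∀ u v → Adj G u v → f u ≢ f v
    differ = proj₂ (proj₁ equitable)

    in-list₁ : ∀ i → f (i ↑ˡ suc m₂) ∈ list₁ i
    in-list₁ i = subst (f (i ↑ˡ suc m₂) ∈_) (cong list-of (splitAt-↑ˡ (suc m₁) i (suc m₂)))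
      (proj₁ (proj₁ equitable) (i ↑ˡ suc m₂))

    in-list₂ : ∀ j → f (suc m₁ ↑ʳ j) ∈ (0 ∷ 1 ∷ [])
    in-list₂ j = subst (f (suc m₁ ↑ʳ j) ∈_) (cong list-of (splitAt-↑ʳ (suc m₁) (suc m₂) j))
      (proj₁ (proj₁ equitable) (suc m₁ ↑ʳ j))

    leaf₁-forced : ∀ i {x} → list₁ (suc i) ≡ f centre₁ ∷ x ∷ [] → f (leaf₁ i) ≡ x
    leaf₁-forced i e = the-other (subst (f (leaf₁ i) ∈_) e (in-list₁ (suc i)))
                                 (λ e′ → differ _ _ (adj₁ i) (sym e′))

    leaves₁-count : Colour → ℕ
    leaves₁-count c = sum (λ i → χ (f (leaf₁ i) ≟ c))

    star₁-count : Colour → ℕ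
    star₁-count c = χ (f centre₁ ≟ c) + leaves₁-count c

    -- All leaves of star 2 take the colour missing at its centre, which bounds the
    -- use of that colour in star 1.
    capacity : ∀ {y′} → Flip (f centre₂) y′ → star₁-count y′ + m₂ ≤ t
    capacity {y′} fl = begin
      star₁-count y′ + m₂
        ≤⟨ +-monoʳ-≤ (star₁-count y′) (≤-trans leaves (m≤n+m _ _)) ⟩
      star₁-count y′ + (χ (f centre₂ ≟ y′) + leaves₂)
        ≡⟨ sym (sum-++ (suc m₁) {suc m₂} (λ v → χ (f v ≟ y′))) ⟩
      count f y′
        ≡⟨ sym (colourClassSize≡count G f y′) ⟩
      colourClassSize G f y′
        ≤⟨ proj₂ equitable y′ ⟩
      t ∎
      where
      open ≤-Reasoning
      leaves₂ : ℕ
      leaves₂ = sum (λ j → χ (f (leaf₂ j) ≟ y′))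
      leaves : m₂ ≤ leaves₂
      leaves = sum-≥ (λ j → χ-yes (f (leaf₂ j) ≟ y′)
                 (flip-other fl (in-list₂ (suc j)) (λ e → differ _ _ (adj₂ j) (sym e))))

    overflow : ∀ {y′ k} → Flip (f centre₂) y′ → k ≤ star₁-count y′ → t < k + m₂ → ⊥
    overflow fl k≤count t<k+m₂ = <⇒≱ t<k+m₂ (≤-trans (+-monoˡ-≤ m₂ k≤count) (capacity fl))

-- Lower bound (a): for m₂ ≥ m₁ + 2 the assignment {0, 1} everywhere fails: star 1
-- has a vertex of colour y′, its centre or else its first leaf, but t ≤ m₂.
unbalanced : ∀ {m₁ m₂} → 1 ≤ m₁ → m₁ + 2 ≤ m₂ → ¬ EquitablyChoosable (Star m₁ ⊕ Star m₂) 2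
unbalanced {suc k} {m₂} _ gap ec = impossible (proj₂ (ec L))
  where
  open LowerBound {suc k} {m₂} (λ _ → 0 ∷ 1 ∷ []) (λ _ ())
  open TwoStars (suc k) m₂

  t≤m₂ : t ≤ m₂
  t≤m₂ = ⌈/2⌉-≤ (subst (_≤ m₂ + m₂) (shift (suc k) m₂) (+-monoˡ-≤ m₂ gap))
    where
    shift : ∀ a b → (a + 2) + b ≡ suc a + suc b
    shift = solve-∀

  impossible : ∀ {f} → IsEquitableLColouring G 2 L f → ⊥
  impossible {f} equitable with flip-of (in-list₂ equitable 0F)
  ... | y′ , fl = overflow equitable fl (one-y′ (f centre₁ ≟ y′)) (s≤s t≤m₂)
    where
    one-y′ : Dec (f centre₁ ≡ y′) → 1 ≤ star₁-count equitable y′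
    one-y′ (yes c≡y′) =
      ≤-trans (χ-yes (f centre₁ ≟ y′) c≡y′) (m≤m+n _ (leaves₁-count equitable y′))
    one-y′ (no c≢y′)  = ≤-trans (χ-yes (f (leaf₁ 0F) ≟ y′) leaf≡y′)
      (≤-trans (sum-≥-term (λ i → χ (f (leaf₁ i) ≟ y′)) 0F) (m≤n+m _ (χ (f centre₁ ≟ y′))))
      where
      centre≡y : f centre₁ ≡ f centre₂
      centre≡y = flip-other (flip-sym fl) (in-list₁ equitable 0F) c≢y′
      leaf≡y′ : f (leaf₁ 0F) ≡ y′
      leaf≡y′ = flip-other fl (in-list₁ equitable 1F)
                  (λ e → differ equitable _ _ (adj₁ 0F) (trans centre≡y (sym e)))

-- Lower bound (b): for 8 ≤ m₁ ≤ m₂ give the centre of star 1 the list {2, 3} and its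
-- leaves two copies of each list {2, 0}, {2, 1}, {3, 0}, {3, 1} (and {2, 0} on the
-- remaining leaves).  Whatever colours z and y′ the centres force, two leaves of star 1
-- have list {z, y′} and take y′, but t ≤ m₂ + 1.
large-leaf-list : ∀ {k} → Fin (8 + k) → Vec Colour 2
large-leaf-list 0F = 2 ∷ 0 ∷ []
large-leaf-list 1F = 2 ∷ 0 ∷ []
large-leaf-list 2F = 2 ∷ 1 ∷ []
large-leaf-list 3F = 2 ∷ 1 ∷ []
large-leaf-list 4F = 3 ∷ 0 ∷ []
large-leaf-list 5F = 3 ∷ 0 ∷ []
large-leaf-list 6F = 3 ∷ 1 ∷ []
large-leaf-list 7F = 3 ∷ 1 ∷ []
large-leaf-list _  = 2 ∷ 0 ∷ []

large-list : ∀ {k} → Fin (suc (8 + k)) → Vec Colour 2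
large-list zero    = 2 ∷ 3 ∷ []
large-list (suc i) = large-leaf-list i

large-list-distinct : ∀ {k} i → Distinct (large-list {k} i)
large-list-distinct zero    = λ ()
large-list-distinct (suc i) = leaf-distinct i
  where
  leaf-distinct : ∀ {k} i → Distinct (large-leaf-list {k} i)
  leaf-distinct 0F = λ ()
  leaf-distinct 1F = λ ()
  leaf-distinct 2F = λ ()
  leaf-distinct 3F = λ ()
  leaf-distinct 4F = λ ()
  leaf-distinct 5F = λ ()
  leaf-distinct 6F = λ ()
  leaf-distinct 7F = λ ()
  leaf-distinct (suc (suc (suc (suc (suc (suc (suc (suc _)))))))) = λ ()

pair-position : ∀ {k z y y′} → z ≡ 2 ⊎ z ≡ 3 → Flip y y′ →
  ∃ λ (p : Fin (7 + k)) →
    large-leaf-list (inject₁ p) ≡ z ∷ y′ ∷ [] × large-leaf-list (suc p) ≡ z ∷ y′ ∷ []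
pair-position (inj₁ refl) 1↔0 = 0F , refl , refl
pair-position (inj₁ refl) 0↔1 = 2F , refl , refl
pair-position (inj₂ refl) 1↔0 = 4F , refl , refl
pair-position (inj₂ refl) 0↔1 = 6F , refl , refl

large : ∀ {m₁ m₂} → 8 ≤ m₁ → m₁ ≤ m₂ → ¬ EquitablyChoosable (Star m₁ ⊕ Star m₂) 2
large {m₁} {m₂} (s≤s (s≤s (s≤s (s≤s (s≤s (s≤s (s≤s (s≤s (z≤n {k}))))))))) m₁≤m₂ ec =
  impossible (proj₂ (ec L))
  where
  open LowerBound {m₁} {m₂} large-list large-list-distinct
  open TwoStars m₁ m₂

  t≤1+m₂ : t ≤ suc m₂
  t≤1+m₂ = ⌈/2⌉-≤ (+-monoˡ-≤ (suc m₂) (s≤s m₁≤m₂))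

  impossible : ∀ {f} → IsEquitableLColouring G 2 L f → ⊥
  impossible {f} equitable with flip-of (in-list₂ equitable 0F) | ∈-pair (in-list₁ equitable 0F)
  ... | y′ , fl | centre-colour with pair-position centre-colour fl
  ... | p , list-p , list-p+1 = overflow equitable fl two-y′ (s≤s t≤1+m₂)
    where
    open ≤-Reasoning
    leaf-count : Fin (8 + k) → ℕ
    leaf-count i = χ (f (leaf₁ i) ≟ y′)
    counted : ∀ i → large-leaf-list i ≡ f centre₁ ∷ y′ ∷ [] → 1 ≤ leaf-count i
    counted i list-i = χ-yes (f (leaf₁ i) ≟ y′) (leaf₁-forced equitable i list-i)
    two-y′ : 2 ≤ star₁-count equitable y′
    two-y′ = begin
      1 + 1                                        ≤⟨ +-mono-≤ (counted (inject₁ p) list-p)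
                                                               (counted (suc p) list-p+1) ⟩
      leaf-count (inject₁ p) + leaf-count (suc p)  ≤⟨ sum-≥-consecutive leaf-count p ⟩
      leaves₁-count equitable y′                   ≤⟨ m≤n+m _ (χ (f centre₁ ≟ y′)) ⟩
      star₁-count equitable y′                     ∎

≤7⇒size : ∀ {m₁ d} → m₁ ≤ 7 → d ≤ 1 → m₁ + (m₁ + d) ≤ 15
≤7⇒size m₁≤7 d≤1 = +-mono-≤ m₁≤7 (+-mono-≤ m₁≤7 d≤1)

size⇒≤7 : ∀ {m₁ d} → m₁ + (m₁ + d) ≤ 15 → m₁ ≤ 7
size⇒≤7 {m₁} {d} size with m₁ ≤? 7
... | yes m₁≤7 = m₁≤7
... | no m₁≰7  = ⊥-elim (<-irrefl refl
  (≤-trans (+-mono-≤ (≰⇒> m₁≰7) (≤-trans (≰⇒> m₁≰7) (m≤m+n m₁ d))) size))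

-- Write m₂ = m₁ + d.  For d ≥ 2 lower bound (a) applies.  For d ≤ 1 the graph is
-- equitably 2-choosable exactly when m₁ ≤ 7, i.e. m₁ + m₂ ≤ 15: by the upper bound
-- when m₁ ≤ 7 and by lower bound (b) when m₁ ≥ 8.
theorem1p4 : (m₁ m₂ : ℕ) → 1 ≤ m₁ → m₁ ≤ m₂ →
    EquitablyChoosable (Star m₁ ⊕ Star m₂) 2 ⇔ ((m₂ ∸ m₁ ≤ 1) × (m₁ + m₂ ≤ 15))
theorem1p4 m₁ m₂ 1≤m₁ m₁≤m₂ with m₂ ∸ m₁ | m+[n∸m]≡n m₁≤m₂
... | d | refl with d ≤? 1
...   | no d≰1  = mk⇔ (λ ec → ⊥-elim (unbalanced 1≤m₁ (+-monoʳ-≤ m₁ (≰⇒> d≰1)) ec))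
                      (λ (d≤1 , _) → ⊥-elim (d≰1 d≤1))
...   | yes d≤1 = mk⇔ (λ ec → d≤1 , ≤7⇒size (small ec) d≤1)
                      (λ (_ , size) → equitably-choosable (feasible-cases 1≤m₁ (size⇒≤7 size) d≤1))
  where
  small : EquitablyChoosable (Star m₁ ⊕ Star (m₁ + d)) 2 → m₁ ≤ 7
  small ec with m₁ ≤? 7
  ... | yes m₁≤7 = m₁≤7
  ... | no m₁≰7  = ⊥-elim (large (≰⇒> m₁≰7) (m≤m+n m₁ d) ec)
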